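{- Let $\varepsilon>0$ and let $S$ be an $\varepsilon$-regular word over the binary alphabet $\{0,1\}$. Then $2f(S)\geq |S|-5\varepsilon|S|$.
   Context: A word of length $m$ over $\{0,1\}$ is a sequence $s_1\ldots s_m$; $S[i,j]=s_i\ldots s_j$ is a factor. For a letter $q$, $d_q(T)$ is the number of letters of $T$ equal to $q$ divided by $|T|$. $S$ of length $m$ is $\varepsilon$-regular if for every integer $i$ with $\varepsilon m+1\leq i\leq m-2\varepsilon m+1$ and every $q\in\{0,1\}$, $|d_q(S)-d_q(S[i,i+\varepsilon m-1])|<\varepsilon$. A (scattered) subword of $S$ is $s_{i_1}\ldots s_{i_r}$ with $i_1<\cdots<i_r$; two subwords are disjoint if their index sets are disjoint. $f(S)$ is the largest $m'$ such that $S$ contains two disjoint subwords that are equal as words and each have length $m'$. Divisibility issues are ignored (e.g. $1/\varepsilon$ and $\varepsilon m$ are treated as integers). -}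

module Defs where

open import Data.Nat as ℕ using (ℕ; zero; suc; _+_; _*_; _∸_; _≤_; _<_; NonZero)
open import Data.Fin using (Fin; _≟_)
open import Data.Integer using (+_)
open import Data.Rational using (ℚ; 0ℚ; _/_; _-_; ∣_∣) renaming (_<_ to _<ℚ_)
open import Data.List using (List; length; filter; take; drop; lookup)
open import Data.Product using (_×_; Σ; ∃-syntax)
open import Relation.Nullary using (¬_)
open import Relation.Binary.PropositionalEquality using (_≡_)

Word : Set
Word = List (Fin 2)

count : Fin 2 → Word → ℕ
count q w = length (filter (q ≟_) w)

-- a / b as a rational (b = 0 never occurs in the uses below; set to 0 then)
frac : ℕ → ℕ → ℚ
frac a zero    = 0ℚ
frac a (suc n) = (+ a) / suc n

dens : Fin 2 → Word → ℚ
dens q w = frac (count q w) (length w)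

-- factor S[i,j] = s_i … s_j  (1-based positions)
factor : Word → ℕ → ℕ → Word
factor S i j = take (suc j ∸ i) (drop (i ∸ 1) S)

-- S is ε-regular, with ε = 1/k and εm = t (divisibility ignored: m = k t).
-- For every i with εm+1 ≤ i ≤ m-2εm+1 and every q,
-- |d_q(S) - d_q(S[i, i+εm-1])| < ε.
Regular : (k : ℕ) .{{_ : NonZero k}} → (t : ℕ) → Word → Set
Regular k t S = ∀ (i : ℕ) (q : Fin 2) → t + 1 ≤ i → i + 2 * t ≤ length S + 1 →
  ∣ dens q S - dens q (factor S i (i + t ∸ 1)) ∣ <ℚ ((+ 1) / k)

-- strictly increasing index map: a scattered subword of S of length r
Increasing : {n r : ℕ} → (Fin r → Fin n) → Set
Increasing {n} {r} I = ∀ (a b : Fin r) → Data.Fin._<_ a b → Data.Fin._<_ (I a) (I b)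

HasTwins : Word → ℕ → Set
HasTwins S r = Σ (Fin r → Fin (length S)) λ I → Σ (Fin r → Fin (length S)) λ J →
  Increasing I × Increasing J ×
  (∀ a b → ¬ (I a ≡ J b)) ×
  (∀ a → lookup S (I a) ≡ lookup S (J a))

-- n = f(S): n is the largest length of two disjoint equal subwords
IsF : Word → ℕ → Set
IsF S n = HasTwins S n × (∀ r → HasTwins S r → r ≤ n)

module Submission where

-- Cut S into k blocks B₀ … B_{k-1} of length t.  Regularity says that every
-- middle block B_j (1 ≤ j ≤ k-2) has nearly the global letter density: for each
-- letter q,  count_q(S) ≤ k · count_q(B_j) + t.
-- Let q₀ be a majority letter of S and alternate q_{j+1} = flip q_j.  In blocks
-- B₁ … B_{k-2} mark, in block j, the first s_j copies of q_j as belonging to the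
-- "left" subword and the first s_{j-1} copies of q_{j-1} as belonging to the
-- "right" one, where s_j = min(count_{q_j}(B_j), count_{q_j}(B_{j+1})).  Both
-- subwords then read q₀^{s₀} q₁^{s₁} …, so they are disjoint equal subwords of
-- length L = Σ s_j.  Summing the density bounds over k-3 blocks and using that
-- alternate letters have total count m while q₀ has count ≥ m/2 gives
-- (k-3) m ≤ 2 (k L + (k-3) t), which rearranges to m ≤ 2 L + 5 t.  (For
-- k ≤ 2 the bound m = k t ≤ 5 t is immediate.)

open import Defs
open import Data.Nat using (ℕ; zero; suc; _+_; _*_; _∸_; _⊓_; _≤_; _<_; NonZero; z≤n; s≤s)
open import Data.Nat.Properties hiding (_≟_)
open import Data.Nat.Tactic.RingSolver using (solve-∀)
open import Data.Fin using (Fin; zero; suc; _≟_)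
import Data.Fin.Properties as Finₚ
open import Data.Integer as ℤ using (+_; -[1+_])
import Data.Integer.Properties as ℤP
import Data.Integer.Tactic.RingSolver as ℤSolver
open import Data.Rational as ℚ using (toℚᵘ) renaming (_<_ to _<ℚ_)
import Data.Rational.Properties as ℚP
open import Data.Rational.Unnormalised as ℚᵘ using (mkℚᵘ; *<*; *≤*)
import Data.Rational.Unnormalised.Properties as ℚᵘP
open import Data.List using (List; []; _∷_; length; map; lookup; _++_; take; drop; replicate)
open import Data.List.Properties using (map-++; ++-identityʳ; length-++; length-replicate; length-take; length-drop; take++drop≡id; drop-drop; filter-accept; filter-reject)
open import Data.List.Relation.Binary.Sublist.Propositional using (_⊆_)
open import Data.List.Relation.Binary.Sublist.Propositional.Properties using (take-⊆; filter⁺; length-mono-≤)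
open import Data.Product using (Σ; _×_; _,_; proj₁; proj₂)
open import Data.Sum using (inj₁; inj₂)
open import Relation.Nullary using (yes; no)
open import Relation.Binary.Definitions using (DecidableEquality)
open import Relation.Binary.PropositionalEquality

flip : Fin 2 → Fin 2
flip zero = suc zero
flip (suc zero) = zero

flip-involutive : ∀ q → flip (flip q) ≡ q
flip-involutive zero = refl
flip-involutive (suc zero) = refl

flip-differs : ∀ q → q ≢ flip q
flip-differs zero ()
flip-differs (suc zero) ()

-- Every letter x is either q itself or flip q; matching on this view
-- lets definitions over an arbitrary q avoid duplicating cases per letter.
data Compare (q : Fin 2) : Fin 2 → Set where
  same  : Compare q q
  other : Compare q (flip q)

compare : ∀ q x → Compare q x
compare zero zero = same
compare zero (suc zero) = other
compare (suc zero) zero = other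
compare (suc zero) (suc zero) = same

count-here : ∀ q w → count q (q ∷ w) ≡ suc (count q w)
count-here q w = cong length (filter-accept (q ≟_) refl)

count-there : ∀ {q x} w → q ≢ x → count q (x ∷ w) ≡ count q w
count-there {q} w q≢x = cong length (filter-reject (q ≟_) q≢x)

count-mono : ∀ q {u w} → u ⊆ w → count q u ≤ count q w
count-mono q u⊆w = length-mono-≤ (filter⁺ (q ≟_) (q ≟_) (λ { refl q≡x → q≡x }) u⊆w)

count-partition : ∀ w → count zero w + count (suc zero) w ≡ length w
count-partition [] = refl
count-partition (zero ∷ w) = cong suc (count-partition w)
count-partition (suc zero ∷ w) =
  trans (+-suc (count zero w) (count (suc zero) w)) (cong suc (count-partition w))

majority : ∀ w → Σ (Fin 2) λ q → length w ≤ 2 * count q w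
majority w with ≤-total (count (suc zero) w) (count zero w)
... | inj₁ c₁≤c₀ = zero , subst (_≤ 2 * count zero w) (count-partition w)
  (+-monoʳ-≤ (count zero w) (≤-trans c₁≤c₀ (m≤m+n (count zero w) 0)))
... | inj₂ c₀≤c₁ = suc zero , subst (_≤ 2 * count (suc zero) w) (count-partition w)
  (+-mono-≤ c₀≤c₁ (m≤m+n (count (suc zero) w) 0))

data Tag : Set where
  left right unused : Tag

_≟ᵗ_ : DecidableEquality Tag
left ≟ᵗ left = yes refl
left ≟ᵗ right = no λ ()
left ≟ᵗ unused = no λ ()
right ≟ᵗ left = no λ ()
right ≟ᵗ right = yes refl
right ≟ᵗ unused = no λ ()
unused ≟ᵗ left = no λ ()
unused ≟ᵗ right = no λ ()
unused ≟ᵗ unused = yes refl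

TaggedWord : Set
TaggedWord = List (Fin 2 × Tag)

letters : TaggedWord → Word
letters = map proj₁

copy : Tag → TaggedWord → Word
copy τ [] = []
copy τ ((x , σ) ∷ Z) with τ ≟ᵗ σ
... | yes _ = x ∷ copy τ Z
... | no _ = copy τ Z

copy-++ : ∀ τ Z Y → copy τ (Z ++ Y) ≡ copy τ Z ++ copy τ Y
copy-++ τ [] Y = refl
copy-++ τ ((x , σ) ∷ Z) Y with τ ≟ᵗ σ
... | yes _ = cong (x ∷_) (copy-++ τ Z Y)
... | no _ = copy-++ τ Z Y

position : ∀ τ Z → Fin (length (copy τ Z)) → Fin (length (letters Z))
position τ ((x , σ) ∷ Z) a with τ ≟ᵗ σ
position τ ((x , σ) ∷ Z) zero | yes _ = zero
position τ ((x , σ) ∷ Z) (suc a) | yes _ = suc (position τ Z a)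
position τ ((x , σ) ∷ Z) a | no _ = suc (position τ Z a)

position-lookup : ∀ τ Z a → lookup (letters Z) (position τ Z a) ≡ lookup (copy τ Z) a
position-lookup τ ((x , σ) ∷ Z) a with τ ≟ᵗ σ
position-lookup τ ((x , σ) ∷ Z) zero | yes _ = refl
position-lookup τ ((x , σ) ∷ Z) (suc a) | yes _ = position-lookup τ Z a
position-lookup τ ((x , σ) ∷ Z) a | no _ = position-lookup τ Z a

position-increasing : ∀ τ Z → Increasing (position τ Z)
position-increasing τ ((x , σ) ∷ Z) a b a<b with τ ≟ᵗ σ
position-increasing τ ((x , σ) ∷ Z) zero (suc b) a<b | yes _ = s≤s z≤n
position-increasing τ ((x , σ) ∷ Z) (suc a) (suc b) (s≤s a<b) | yes _ =
  s≤s (position-increasing τ Z a b a<b)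
position-increasing τ ((x , σ) ∷ Z) a b a<b | no _ = s≤s (position-increasing τ Z a b a<b)

position-disjoint : ∀ {τ τ′} → τ ≢ τ′ → ∀ Z a b → position τ Z a ≢ position τ′ Z b
position-disjoint {τ} {τ′} τ≢τ′ ((x , σ) ∷ Z) a b eq with τ ≟ᵗ σ | τ′ ≟ᵗ σ
position-disjoint τ≢τ′ ((x , σ) ∷ Z) a b eq | yes refl | yes refl = τ≢τ′ refl
position-disjoint τ≢τ′ ((x , σ) ∷ Z) zero b () | yes _ | no _
position-disjoint τ≢τ′ ((x , σ) ∷ Z) (suc a) b eq | yes _ | no _ =
  position-disjoint τ≢τ′ Z a b (Finₚ.suc-injective eq)
position-disjoint τ≢τ′ ((x , σ) ∷ Z) a zero () | no _ | yes _
position-disjoint τ≢τ′ ((x , σ) ∷ Z) a (suc b) eq | no _ | yes _ =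
  position-disjoint τ≢τ′ Z a b (Finₚ.suc-injective eq)
position-disjoint τ≢τ′ ((x , σ) ∷ Z) a b eq | no _ | no _ =
  position-disjoint τ≢τ′ Z a b (Finₚ.suc-injective eq)

positionAlong : ∀ τ Z {u} → copy τ Z ≡ u → Fin (length u) → Fin (length (letters Z))
positionAlong τ Z refl = position τ Z

twins-of-tagging : ∀ Z {u} → copy left Z ≡ u → copy right Z ≡ u → HasTwins (letters Z) (length u)
twins-of-tagging Z {u} eqˡ eqʳ =
  positionAlong left Z eqˡ , positionAlong right Z eqʳ ,
  increasing eqˡ , increasing eqʳ ,
  disjoint eqˡ eqʳ ,
  λ a → trans (lookup-along eqˡ a) (sym (lookup-along eqʳ a))
  where
  increasing : ∀ {τ} (e : copy τ Z ≡ u) → Increasing (positionAlong τ Z e)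
  increasing refl = position-increasing _ Z
  disjoint : ∀ {v w} (eˡ : copy left Z ≡ v) (eʳ : copy right Z ≡ w) →
    ∀ a b → positionAlong left Z eˡ a ≢ positionAlong right Z eʳ b
  disjoint refl refl = position-disjoint (λ ()) Z
  lookup-along : ∀ {τ} (e : copy τ Z ≡ u) a → lookup (letters Z) (positionAlong τ Z e a) ≡ lookup u a
  lookup-along refl = position-lookup _ Z

tagBlock : Fin 2 → ℕ → ℕ → Word → TaggedWord
tagLetter : ∀ {q x} → Compare q x → ℕ → ℕ → Word → TaggedWord

tagBlock q a b [] = []
tagBlock q a b (x ∷ w) = tagLetter (compare q x) a b w

tagLetter {q} same (suc a) b w = (q , left) ∷ tagBlock q a b w
tagLetter {q} same zero b w = (q , unused) ∷ tagBlock q zero b w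
tagLetter {q} other a (suc b) w = (flip q , right) ∷ tagBlock q a b w
tagLetter {q} other a zero w = (flip q , unused) ∷ tagBlock q a zero w

tagBlock-letters : ∀ q a b w → letters (tagBlock q a b w) ≡ w
tagLetter-letters : ∀ {q x} (c : Compare q x) a b w → letters (tagLetter c a b w) ≡ x ∷ w

tagBlock-letters q a b [] = refl
tagBlock-letters q a b (x ∷ w) = tagLetter-letters (compare q x) a b w

tagLetter-letters {q} same (suc a) b w = cong (q ∷_) (tagBlock-letters q a b w)
tagLetter-letters {q} same zero b w = cong (q ∷_) (tagBlock-letters q zero b w)
tagLetter-letters {q} other a (suc b) w = cong (flip q ∷_) (tagBlock-letters q a b w)
tagLetter-letters {q} other a zero w = cong (flip q ∷_) (tagBlock-letters q a zero w)

tagBlock-left : ∀ q a b w → a ≤ count q w → copy left (tagBlock q a b w) ≡ replicate a q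
tagLetter-left : ∀ {q x} (c : Compare q x) a b w → a ≤ count q (x ∷ w) →
  copy left (tagLetter c a b w) ≡ replicate a q

tagBlock-left q zero b [] a≤ = refl
tagBlock-left q a b (x ∷ w) a≤ = tagLetter-left (compare q x) a b w a≤

tagLetter-left {q} same (suc a) b w a≤ =
  cong (q ∷_) (tagBlock-left q a b w (≤-pred (subst (suc a ≤_) (count-here q w) a≤)))
tagLetter-left {q} same zero b w a≤ = tagBlock-left q zero b w z≤n
tagLetter-left {q} other a (suc b) w a≤ =
  tagBlock-left q a b w (subst (a ≤_) (count-there w (flip-differs q)) a≤)
tagLetter-left {q} other a zero w a≤ =
  tagBlock-left q a zero w (subst (a ≤_) (count-there w (flip-differs q)) a≤)

tagBlock-right : ∀ q a b w → b ≤ count (flip q) w → copy right (tagBlock q a b w) ≡ replicate b (flip q)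
tagLetter-right : ∀ {q x} (c : Compare q x) a b w → b ≤ count (flip q) (x ∷ w) →
  copy right (tagLetter c a b w) ≡ replicate b (flip q)

tagBlock-right q a zero [] b≤ = refl
tagBlock-right q a b (x ∷ w) b≤ = tagLetter-right (compare q x) a b w b≤

tagLetter-right {q} same (suc a) b w b≤ =
  tagBlock-right q a b w (subst (b ≤_) (count-there w (≢-sym (flip-differs q))) b≤)
tagLetter-right {q} same zero b w b≤ =
  tagBlock-right q zero b w (subst (b ≤_) (count-there w (≢-sym (flip-differs q))) b≤)
tagLetter-right {q} other a (suc b) w b≤ =
  cong (flip q ∷_) (tagBlock-right q a b w (≤-pred (subst (suc b ≤_) (count-here (flip q) w) b≤)))
tagLetter-right {q} other a zero w b≤ = tagBlock-right q a zero w z≤n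

-- The j-th block of length t of w (counting from 0).
block : ℕ → ℕ → Word → Word
block t j w = take t (drop (j * t) w)

block-suc : ∀ t j w → block t (suc j) w ≡ block t j (drop t w)
block-suc t j w = cong (take t) (sym (drop-drop t (j * t) w))

shared : ℕ → Fin 2 → Word → ℕ
shared t q w = count q (take t w) ⊓ count q (take t (drop t w))

-- alternate t q r n w tags the blocks 0, …, n of w (block n absorbing the rest
-- of w), using letter q in block 0 and alternating afterwards.  Block j gets
-- s_j left tags on its own letter q_j (s_j = shared count with the next block,
-- s_n = 0) and s_{j-1} right tags on the previous letter (s_{-1} = r).
alternate : ℕ → Fin 2 → ℕ → ℕ → Word → TaggedWord
alternate t q r zero w = tagBlock q 0 r w
alternate t q r (suc n) w =
  tagBlock q (shared t q w) r (take t w) ++ alternate t (flip q) (shared t q w) n (drop t w)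

letters-++ : ∀ Z Y → letters (Z ++ Y) ≡ letters Z ++ letters Y
letters-++ = map-++ proj₁

alternate-letters : ∀ t q r n w → letters (alternate t q r n w) ≡ w
alternate-letters t q r zero w = tagBlock-letters q 0 r w
alternate-letters t q r (suc n) w = begin
  letters (tagBlock q s r (take t w) ++ alternate t (flip q) s n (drop t w))
    ≡⟨ letters-++ (tagBlock q s r (take t w)) _ ⟩
  letters (tagBlock q s r (take t w)) ++ letters (alternate t (flip q) s n (drop t w))
    ≡⟨ cong₂ _++_ (tagBlock-letters q s r (take t w)) (alternate-letters t (flip q) s n (drop t w)) ⟩
  take t w ++ drop t w
    ≡⟨ take++drop≡id t w ⟩
  w ∎
  where open ≡-Reasoning
        s = shared t q w

-- The right copy is the left copy shifted by one block: it starts with the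
-- r right tags of block 0 and then repeats each block's left tags one block later.
alternate-right : ∀ t q r n w → r ≤ count (flip q) (take t w) →
  copy right (alternate t q r n w) ≡ replicate r (flip q) ++ copy left (alternate t q r n w)
alternate-right t q r zero w r≤ = begin
  copy right (tagBlock q 0 r w)
    ≡⟨ tagBlock-right q 0 r w (≤-trans r≤ (count-mono (flip q) (take-⊆ t w))) ⟩
  replicate r (flip q)
    ≡⟨ sym (++-identityʳ _) ⟩
  replicate r (flip q) ++ []
    ≡⟨ cong (replicate r (flip q) ++_) (sym (tagBlock-left q 0 r w z≤n)) ⟩
  replicate r (flip q) ++ copy left (tagBlock q 0 r w) ∎
  where open ≡-Reasoning
alternate-right t q r (suc n) w r≤ = begin
  copy right (B ++ R)
    ≡⟨ copy-++ right B R ⟩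
  copy right B ++ copy right R
    ≡⟨ cong₂ _++_ (tagBlock-right q s r (take t w) r≤) (alternate-right t (flip q) s n (drop t w) s≤) ⟩
  replicate r (flip q) ++ (replicate s (flip (flip q)) ++ copy left R)
    ≡⟨ cong (λ x → replicate r (flip q) ++ (replicate s x ++ copy left R)) (flip-involutive q) ⟩
  replicate r (flip q) ++ (replicate s q ++ copy left R)
    ≡⟨ cong (λ u → replicate r (flip q) ++ (u ++ copy left R)) (sym (tagBlock-left q s r (take t w) (m⊓n≤m _ _))) ⟩
  replicate r (flip q) ++ (copy left B ++ copy left R)
    ≡⟨ cong (replicate r (flip q) ++_) (sym (copy-++ left B R)) ⟩
  replicate r (flip q) ++ copy left (B ++ R) ∎
  where
  open ≡-Reasoning
  s = shared t q w
  B = tagBlock q s r (take t w)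
  R = alternate t (flip q) s n (drop t w)
  s≤ : s ≤ count (flip (flip q)) (take t (drop t w))
  s≤ = subst (λ x → s ≤ count x (take t (drop t w))) (sym (flip-involutive q)) (m⊓n≤n _ _)

alternate-left-length : ∀ t q r n w →
  length (copy left (alternate t q r (suc n) w))
    ≡ shared t q w + length (copy left (alternate t (flip q) (shared t q w) n (drop t w)))
alternate-left-length t q r n w = begin
  length (copy left (B ++ R))            ≡⟨ cong length (copy-++ left B R) ⟩
  length (copy left B ++ copy left R)    ≡⟨ length-++ (copy left B) ⟩
  length (copy left B) + length (copy left R)
    ≡⟨ cong (λ u → length u + length (copy left R)) (tagBlock-left q s r (take t w) (m⊓n≤m _ _)) ⟩
  length (replicate s q) + length (copy left R)
    ≡⟨ cong (_+ length (copy left R)) (length-replicate s) ⟩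
  s + length (copy left R) ∎
  where
  open ≡-Reasoning
  s = shared t q w
  B = tagBlock q s r (take t w)
  R = alternate t (flip q) s n (drop t w)

alternatingSum : (Fin 2 → ℕ) → Fin 2 → ℕ → ℕ
alternatingSum C q zero = 0
alternatingSum C q (suc n) = C q + alternatingSum C (flip q) n

bound-⊓ : ∀ k t c x y → c ≤ k * x + t → c ≤ k * y + t → c ≤ k * (x ⊓ y) + t
bound-⊓ k t c x y c≤x c≤y = begin
  c                           ≤⟨ ⊓-glb c≤x c≤y ⟩
  (k * x + t) ⊓ (k * y + t)   ≡⟨ +-distribʳ-⊓ t (k * x) (k * y) ⟨
  ((k * x) ⊓ (k * y)) + t     ≡⟨ cong (_+ t) (*-distribˡ-⊓ k x y) ⟨
  k * (x ⊓ y) + t ∎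
  where open ≤-Reasoning

-- If C p ≤ k · count_p(B_j) + t for every letter p and every block B_j with
-- j ≤ n, the left copy of an alternating tagging is long: each shared count s_j
-- is at least (C q_j - t)/k.
alternating-sum-bound : ∀ k t (C : Fin 2 → ℕ) q r n w →
  (∀ j → j ≤ n → ∀ p → C p ≤ k * count p (block t j w) + t) →
  alternatingSum C q n ≤ k * length (copy left (alternate t q r n w)) + n * t
alternating-sum-bound k t C q r zero w dense = z≤n
alternating-sum-bound k t C q r (suc n) w dense = begin
  C q + alternatingSum C (flip q) n    ≤⟨ +-mono-≤ first rest ⟩
  (k * s + t) + (k * L + n * t)       ≡⟨ regroup k s L t n ⟩
  k * (s + L) + suc n * t             ≡⟨ cong (λ x → k * x + suc n * t) (alternate-left-length t q r n w) ⟨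
  k * length (copy left (alternate t q r (suc n) w)) + suc n * t ∎
  where
  open ≤-Reasoning
  s = shared t q w
  L = length (copy left (alternate t (flip q) s n (drop t w)))
  regroup : ∀ k s L t n → (k * s + t) + (k * L + n * t) ≡ k * (s + L) + suc n * t
  regroup = solve-∀
  first : C q ≤ k * s + t
  first = bound-⊓ k t (C q) _ _ (dense 0 z≤n q)
    (subst (λ B → C q ≤ k * count q B + t) (block-suc t 0 w) (dense 1 (s≤s z≤n) q))
  dense′ : ∀ j → j ≤ n → ∀ p → C p ≤ k * count p (block t j (drop t w)) + t
  dense′ j j≤n p = subst (λ B → C p ≤ k * count p B + t) (block-suc t j w) (dense (suc j) (s≤s j≤n) p)
  rest : alternatingSum C (flip q) n ≤ k * L + n * t
  rest = alternating-sum-bound k t C (flip q) s n (drop t w) dense′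

alternatingSum-majority : ∀ (C : Fin 2 → ℕ) m q → C q + C (flip q) ≡ m → m ≤ 2 * C q →
  ∀ n → n * m ≤ 2 * alternatingSum C q n
alternatingSum-majority C m q total half zero = z≤n
alternatingSum-majority C m q total half (suc zero) =
  subst₂ _≤_ (sym (+-identityʳ m)) (cong (2 *_) (sym (+-identityʳ (C q)))) half
alternatingSum-majority C m q total half (suc (suc n)) rewrite flip-involutive q = begin
  (2 + n) * m                                   ≡⟨ split n m ⟩
  2 * m + n * m                                 ≤⟨ +-monoʳ-≤ (2 * m) (alternatingSum-majority C m q total half n) ⟩
  2 * m + 2 * alternatingSum C q n              ≡⟨ cong (λ x → 2 * x + 2 * alternatingSum C q n) total ⟨
  2 * (C q + C (flip q)) + 2 * alternatingSum C q n
                                                ≡⟨ regroup (C q) (C (flip q)) (alternatingSum C q n) ⟩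
  2 * (C q + (C (flip q) + alternatingSum C q n)) ∎
  where
  open ≤-Reasoning
  split : ∀ n m → (2 + n) * m ≡ 2 * m + n * m
  split = solve-∀
  regroup : ∀ a b c → 2 * (a + b) + 2 * c ≡ 2 * (a + (b + c))
  regroup = solve-∀

≤-abs : ∀ p → p ℚᵘ.≤ ℚᵘ.∣ p ∣
≤-abs (mkℚᵘ (+ n) d) = ℚᵘP.≤-refl
≤-abs (mkℚᵘ -[1+ n ] d) = *≤* (ℤP.*-monoʳ-≤-nonNeg (+ suc d) (ℤ.-≤+ {n} {suc n}))

-- |x - y| < z gives x - y < z, stated on unnormalised representatives so that
-- the inequality can be cross-multiplied.
difference-below : ∀ x y z → ℚ.∣ x ℚ.- y ∣ <ℚ z → toℚᵘ x ℚᵘ.- toℚᵘ y ℚᵘ.< toℚᵘ z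
difference-below x y z gap =
  ℚᵘP.≤-<-trans (ℚᵘP.≤-reflexive homo)
    (ℚᵘP.≤-<-trans (≤-abs _) (ℚᵘP.<-respˡ-≃ (ℚP.toℚᵘ-homo-∣-∣ (x ℚ.- y)) (ℚP.toℚᵘ-mono-< gap)))
  where
  homo : toℚᵘ x ℚᵘ.- toℚᵘ y ℚᵘ.≃ toℚᵘ (x ℚ.- y)
  homo = ℚᵘP.≃-sym (ℚᵘP.≃-trans (ℚP.toℚᵘ-homo-+ x (ℚ.- y)) (ℚᵘP.+-congʳ (toℚᵘ x) (ℚP.toℚᵘ-homo‿- y)))

-- The cross-multiplied form of  a/(KT) - b/T < 1/K  (K = suc k′, T = suc t′)
-- is K T (a - b K) < K T · T, hence a - b K < T.
cross-multiplied : ∀ a b k′ t′ →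
  ((+ a) ℤ.* (+ suc t′) ℤ.+ (ℤ.- (+ b)) ℤ.* (+ (suc k′ * suc t′))) ℤ.* (+ suc k′)
    ℤ.< (+ 1) ℤ.* (+ ((suc k′ * suc t′) * suc t′)) →
  a ≤ suc k′ * b + suc t′
cross-multiplied a b k′ t′ lt = to-ℕ (ℤP.+-monoˡ-< (B ℤ.* K) (ℤP.*-cancelˡ-<-nonNeg {j = T} (+ M) scaled))
  where
  K = + suc k′
  T = + suc t′
  A = + a
  B = + b
  M = suc k′ * suc t′
  M≡KT : + M ≡ K ℤ.* T
  M≡KT = ℤP.pos-* (suc k′) (suc t′)
  factorise : ∀ A B K T → (A ℤ.* T ℤ.+ (ℤ.- B) ℤ.* (K ℤ.* T)) ℤ.* K ≡ (K ℤ.* T) ℤ.* (A ℤ.- B ℤ.* K)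
  factorise = ℤSolver.solve-∀
  scaled : + M ℤ.* (A ℤ.- B ℤ.* K) ℤ.< + M ℤ.* T
  scaled = subst₂ ℤ._<_
    (trans (cong (λ m → (A ℤ.* T ℤ.+ (ℤ.- B) ℤ.* m) ℤ.* K) M≡KT)
           (trans (factorise A B K T) (cong (ℤ._* (A ℤ.- B ℤ.* K)) (sym M≡KT))))
    (trans (ℤP.*-identityˡ _) (ℤP.pos-* M (suc t′))) lt
  cancel : ∀ A C → (A ℤ.- C) ℤ.+ C ≡ A
  cancel = ℤSolver.solve-∀
  T+bK : T ℤ.+ B ℤ.* K ≡ + (suc t′ + b * suc k′)
  T+bK = trans (cong (λ x → T ℤ.+ x) (sym (ℤP.pos-* b (suc k′)))) (sym (ℤP.pos-+ (suc t′) (b * suc k′)))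
  reorder : suc t′ + b * suc k′ ≡ suc k′ * b + suc t′
  reorder = trans (+-comm (suc t′) (b * suc k′)) (cong (_+ suc t′) (*-comm b (suc k′)))
  to-ℕ : (A ℤ.- B ℤ.* K) ℤ.+ B ℤ.* K ℤ.< T ℤ.+ B ℤ.* K → a ≤ suc k′ * b + suc t′
  to-ℕ lt′ with subst₂ ℤ._<_ (cancel A (B ℤ.* K)) T+bK lt′
  ... | ℤ.+<+ a<T+bK = <⇒≤ (subst (a <_) reorder a<T+bK)

-- Since
-- frac a (suc n) is the normalisation of mkℚᵘ (+ a) n, toℚᵘ-fromℚᵘ turns the gap
-- into an inequality of explicit fractions, whose cross-multiplied form is the
-- hypothesis of cross-multiplied.
density-gap : ∀ a b k′ t′ →
  ℚ.∣ frac a (suc k′ * suc t′) ℚ.- frac b (suc t′) ∣ <ℚ (+ 1) ℚ./ suc k′ →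
  a ≤ suc k′ * b + suc t′
density-gap a b k′ t′ gap with
  ℚᵘP.<-respʳ-≃ (ℚP.toℚᵘ-fromℚᵘ (mkℚᵘ (+ 1) k′))
    (ℚᵘP.<-respˡ-≃ (ℚᵘP.+-cong (ℚP.toℚᵘ-fromℚᵘ (mkℚᵘ (+ a) (t′ + k′ * suc t′)))
                               (ℚᵘP.-‿cong (ℚP.toℚᵘ-fromℚᵘ (mkℚᵘ (+ b) t′))))
      (difference-below (frac a (suc k′ * suc t′)) (frac b (suc t′)) ((+ 1) ℚ./ suc k′) gap))
... | *<* lt = cross-multiplied a b k′ t′ lt

factor-block : ∀ t j w → factor w (suc (j * t)) (suc (j * t) + t ∸ 1) ≡ block t j w
factor-block t j w = cong (λ n → take n (drop (j * t) w)) (m+n∸m≡n (j * t) t)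

length-block : ∀ t j w → j * t + t ≤ length w → length (block t j w) ≡ t
length-block t j w fits = begin
  length (take t (drop (j * t) w))   ≡⟨ length-take t (drop (j * t) w) ⟩
  t ⊓ length (drop (j * t) w)        ≡⟨ m≤n⇒m⊓n≡m t≤rest ⟩
  t ∎
  where
  open ≡-Reasoning
  t≤rest : t ≤ length (drop (j * t) w)
  t≤rest = subst (t ≤_) (sym (length-drop (j * t) w))
    (m+n≤o⇒m≤o∸n t (subst (_≤ length w) (+-comm (j * t) t) fits))

-- In a regular word of k blocks, each middle block B_j (1 ≤ j ≤ k-2) satisfies
-- count_q(S) ≤ k · count_q(B_j) + t: this is the window condition at i = j t + 1.
regular-block : ∀ k′ t′ S → length S ≡ suc k′ * suc t′ → Regular (suc k′) (suc t′) S →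
  ∀ j → 1 ≤ j → j + 2 ≤ suc k′ → ∀ q → count q S ≤ suc k′ * count q (block (suc t′) j S) + suc t′
regular-block k′ t′ S len regular j 1≤j j+2≤k q = density-gap (count q S) (count q B) k′ t′ gap
  where
  K = suc k′
  T = suc t′
  B = block T j S
  Gap : ℕ → Word → ℕ → Set
  Gap m u n = ℚ.∣ frac (count q S) m ℚ.- frac (count q u) n ∣ <ℚ (+ 1) ℚ./ K
  shift : ∀ j T → suc (j * T) + 2 * T ≡ (j + 2) * T + 1
  shift = solve-∀
  blocks : ∀ j T → j * T + T + T ≡ (j + 2) * T
  blocks = solve-∀
  ≤-KT : (j + 2) * T ≤ length S
  ≤-KT = subst ((j + 2) * T ≤_) (sym len) (*-monoˡ-≤ T j+2≤k)
  fits : j * T + T ≤ length S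
  fits = ≤-trans (m≤m+n (j * T + T) T) (subst (_≤ length S) (sym (blocks j T)) ≤-KT)
  lower : T + 1 ≤ suc (j * T)
  lower = subst (_≤ suc (j * T)) (+-comm 1 T) (s≤s (≤-trans (m≤m+n T 0) (*-monoˡ-≤ T 1≤j)))
  upper : suc (j * T) + 2 * T ≤ length S + 1
  upper = subst (_≤ length S + 1) (sym (shift j T)) (+-monoˡ-≤ 1 ≤-KT)
  window : Gap (length S) B (length B)
  window = subst (λ u → Gap (length S) u (length u)) (factor-block T j S) (regular (suc (j * T)) q lower upper)
  gap : Gap (K * T) B T
  gap = subst₂ (λ m n → Gap m B n) len (length-block T j S fits) window

count-flip-partition : ∀ q w → count q w + count (flip q) w ≡ length w
count-flip-partition zero w = count-partition w
count-flip-partition (suc zero) w = trans (+-comm (count (suc zero) w) (count zero w)) (count-partition w)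

rearrange : ∀ N T m L F → m ≡ (3 + N) * T → N * m ≤ 2 * F → F ≤ (3 + N) * L + N * T →
  m ≤ 2 * L + 5 * T
rearrange N T m L F m≡KT Nm≤2F F≤ = *-cancelˡ-≤ K (begin
  K * m                               ≡⟨ split N m ⟩
  N * m + 3 * m                       ≤⟨ +-monoˡ-≤ (3 * m) (≤-trans Nm≤2F (*-monoʳ-≤ 2 F≤)) ⟩
  2 * (K * L + N * T) + 3 * m         ≡⟨ cong (λ x → 2 * (K * L + N * T) + 3 * x) m≡KT ⟩
  2 * (K * L + N * T) + 3 * (K * T)   ≤⟨ +-monoˡ-≤ (3 * (K * T)) (*-monoʳ-≤ 2 (+-monoʳ-≤ (K * L) (*-monoˡ-≤ T N≤K))) ⟩
  2 * (K * L + K * T) + 3 * (K * T)   ≡⟨ collect K L T ⟩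
  K * (2 * L + 5 * T) ∎)
  where
  open ≤-Reasoning
  K = 3 + N
  N≤K : N ≤ K
  N≤K = m≤n+m N 3
  split : ∀ N m → (3 + N) * m ≡ N * m + 3 * m
  split = solve-∀
  collect : ∀ K L T → 2 * (K * L + K * T) + 3 * (K * T) ≡ K * (2 * L + 5 * T)
  collect = solve-∀

-- A regular word of N + 3 blocks of length T has twins of some length L with
-- m ≤ 2L + 5T: block 0 is left untagged and blocks 1 … N+1 are tagged
-- alternately, starting from a majority letter q.
long-twins : ∀ N t′ S → length S ≡ (3 + N) * suc t′ → Regular (3 + N) (suc t′) S →
  Σ ℕ λ L → HasTwins S L × length S ≤ 2 * L + 5 * suc t′
long-twins N t′ S len regular =
  L , subst (λ w → HasTwins w L) letters-Z (twins-of-tagging Z left-Z right-Z) ,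
  rearrange N T (length S) L (alternatingSum C q N) len
    (alternatingSum-majority C (length S) q (count-flip-partition q S) half N)
    (alternating-sum-bound (3 + N) T C q 0 N (drop T S) dense)
  where
  T = suc t′
  q = proj₁ (majority S)
  half = proj₂ (majority S)
  C : Fin 2 → ℕ
  C p = count p S
  R = alternate T q 0 N (drop T S)
  Z = tagBlock q 0 0 (take T S) ++ R
  L = length (copy left R)
  letters-Z : letters Z ≡ S
  letters-Z = trans (letters-++ (tagBlock q 0 0 (take T S)) R)
    (trans (cong₂ _++_ (tagBlock-letters q 0 0 (take T S)) (alternate-letters T q 0 N (drop T S)))
           (take++drop≡id T S))
  left-Z : copy left Z ≡ copy left R
  left-Z = trans (copy-++ left (tagBlock q 0 0 (take T S)) R)
    (cong (_++ copy left R) (tagBlock-left q 0 0 (take T S) z≤n))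
  right-Z : copy right Z ≡ copy left R
  right-Z = trans (copy-++ right (tagBlock q 0 0 (take T S)) R)
    (cong₂ _++_ (tagBlock-right q 0 0 (take T S) z≤n) (alternate-right T q 0 N (drop T S) z≤n))
  dense : ∀ j → j ≤ N → ∀ p → C p ≤ (3 + N) * count p (block T j (drop T S)) + T
  dense j j≤N p = subst (λ B → C p ≤ (3 + N) * count p B + T) (block-suc T j S)
    (regular-block (2 + N) t′ S len regular (suc j) (s≤s z≤n)
      (s≤s (subst (j + 2 ≤_) (+-comm N 2) (+-monoˡ-≤ 2 j≤N))) p)

few-blocks : ∀ k t m n → k ≤ 5 → m ≡ k * t → m ≤ 2 * n + 5 * t
few-blocks k t m n k≤5 m≡kt = ≤-trans (≤-trans (≤-reflexive m≡kt) (*-monoˡ-≤ t k≤5)) (m≤n+m (5 * t) (2 * n))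

claim7 : (k : ℕ) .{{_ : NonZero k}} (t : ℕ) .{{_ : NonZero t}} (S : Word) →
    length S ≡ k * t → Regular k t S → (n : ℕ) → IsF S n →
    length S ≤ 2 * n + 5 * t
claim7 (suc (suc (suc N))) (suc t′) S len regular n (_ , maximal) =
  use-maximality (long-twins N t′ S len regular)
  where
  use-maximality : Σ ℕ (λ L → HasTwins S L × length S ≤ 2 * L + 5 * suc t′) → length S ≤ 2 * n + 5 * suc t′
  use-maximality (L , twins , bound) = ≤-trans bound (+-monoˡ-≤ (5 * suc t′) (*-monoʳ-≤ 2 (maximal L twins)))
claim7 (suc (suc (suc N))) zero S len _ n _ = ≤-trans (≤-reflexive (trans len (*-zeroʳ (3 + N)))) z≤n
claim7 zero t S len _ n _ = few-blocks 0 t (length S) n z≤n len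
claim7 (suc zero) t S len _ n _ = few-blocks 1 t (length S) n (s≤s z≤n) len
claim7 (suc (suc zero)) t S len _ n _ = few-blocks 2 t (length S) n (s≤s (s≤s z≤n)) len
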